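{- Let $\mathcal C\in\{\mathrm{ID},\mathrm{CD}\}$. The rule $(id)$ is height-preserving admissible in $\mathsf{LBIQ}(\mathcal C)$: if $\mathcal R,\mathcal T,w:x,u:x,\Gamma\vdash\Delta$ is a sequent with $w\twoheadrightarrow^*_{\mathcal R}u$ that has a proof of height $n$ in $\mathsf{LBIQ}(\mathcal C)$, then $\mathcal R,\mathcal T,w:x,\Gamma\vdash\Delta$ has a proof of height at most $n$ in $\mathsf{LBIQ}(\mathcal C)$.
   Context: Syntax. Terms from variables and function symbols (constants have arity $0$); $\mathrm{Ter}(X)$ = terms with variables in $X$ (contains all constants), $\mathrm{Ter}=\mathrm{Ter}(\mathrm{Var})$, $\mathrm{VT}(t)$ variables of $t$, $\mathrm{VT}(\vec t)=\bigcup_i\mathrm{VT}(t_i)$. Formulae: $\varphi::=p(\vec t)\mid\bot\mid\top\mid\varphi\wedge\varphi\mid\varphi\vee\varphi\mid\varphi\mathbin{ -\!\!<}\varphi\mid\varphi\to\varphi\mid\exists x\varphi\mid\forall x\varphi$ ($\mathbin{ -\!\!<}$ exclusion); $\varphi(t/x)$ capture-avoiding substitution. Sequents. Labeled formula $w:\varphi$, relational atom $wRu$, domain atom $w:x$. A sequent is $\mathcal R,\mathcal T,\Gamma\vdash\Delta$ ($\mathcal R$ finite multiset of relational atoms, $\mathcal T$ of domain atoms, $\Gamma,\Delta$ of labeled formulae) with (1) if $\mathcal R\ne\emptyset$ every label in $\mathcal T,\Gamma,\Delta$ occurs in $\mathcal R$, and if $\mathcal R=\emptyset$ exactly one label occurs;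 (2) the directed graph of $\mathcal R$ connected without directed or undirected cycles. $w\twoheadrightarrow^*_{\mathcal R}u$ iff $w=u$ or there is a chain $wRv_1,\dots,v_nRu$ in $\mathcal R$. $X_w=\{x\mid u:x\in\mathcal T,\ u\twoheadrightarrow^*_{\mathcal R}w\}$; $t$ available for $w$ iff $t\in\mathrm{Ter}(X_w)$. Fresh = not occurring in the conclusion; side conditions evaluated in the conclusion. $\mathsf{LBIQ}(\mathrm{ID})$ (premises$\,/\,$conclusion, unchanged parts omitted): (ax) $\Gamma,w:p(\vec t)\vdash\Delta,u:p(\vec t)$ if $w\twoheadrightarrow^*_{\mathcal R}u$; $(\bot L)$ $\Gamma,w:\bot\vdash\Delta$; $(\top R)$ $\Gamma\vdash\Delta,w:\top$; $(\wedge L)$ $\Gamma,w:\varphi,w:\psi\vdash\Delta\,/\,\Gamma,w:\varphi\wedge\psi\vdash\Delta$; $(\wedge R)$ $\Gamma\vdash\Delta,w:\varphi$ and $\Gamma\vdash\Delta,w:\psi\,/\,\Gamma\vdash\Delta,w:\varphi\wedge\psi$; $(\vee L)$ $\Gamma,w:\varphi\vdash\Delta$ and $\Gamma,w:\psi\vdash\Delta\,/\,\Gamma,w:\varphi\vee\psi\vdash\Delta$; $(\vee R)$ $\Gamma\vdash\Delta,w:\varphi,w:\psi\,/\,\Gamma\vdash\Delta,w:\varphi\vee\psi$; $(\to L)$ $\Gamma,w:\varphi\to\psi\vdash\Delta,u:\varphi$ and $\Gamma,w:\varphi\to\psi,u:\psi\vdash\Delta\,/\,\Gamma,w:\varphi\to\psi\vdash\Delta$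 if $w\twoheadrightarrow^*_{\mathcal R}u$; $(\to R)$ $\mathcal R,wRu,\mathcal T,\Gamma,u:\varphi\vdash\Delta,u:\psi\,/\,\mathcal R,\mathcal T,\Gamma\vdash\Delta,w:\varphi\to\psi$, $u$ fresh; $(\mathbin{ -\!\!<}L)$ $\mathcal R,uRw,\mathcal T,\Gamma,u:\varphi\vdash\Delta,u:\psi\,/\,\mathcal R,\mathcal T,\Gamma,w:\varphi\mathbin{ -\!\!<}\psi\vdash\Delta$, $u$ fresh; $(\mathbin{ -\!\!<}R)$ $\Gamma\vdash\Delta,u:\varphi\mathbin{ -\!\!<}\psi,w:\varphi$ and $\Gamma,w:\psi\vdash\Delta,u:\varphi\mathbin{ -\!\!<}\psi\,/\,\Gamma\vdash\Delta,u:\varphi\mathbin{ -\!\!<}\psi$ if $w\twoheadrightarrow^*_{\mathcal R}u$; $(\exists L)$ $\mathcal R,\mathcal T,w:y,\Gamma,w:\varphi(y/x)\vdash\Delta\,/\,\mathcal R,\mathcal T,\Gamma,w:\exists x\varphi\vdash\Delta$, $y$ fresh; $(\exists R)$ $\Gamma\vdash\Delta,w:\exists x\varphi,w:\varphi(t/x)\,/\,\Gamma\vdash\Delta,w:\exists x\varphi$ if $t$ available for $w$; $(\forall L)$ $\Gamma,w:\forall x\varphi,u:\varphi(t/x)\vdash\Delta\,/\,\Gamma,w:\forall x\varphi\vdash\Delta$ if $w\twoheadrightarrow^*_{\mathcal R}u$ and $t$ available for $u$; $(\forall R)$ $\mathcal R,wRu,\mathcal T,u:y,\Gamma\vdash\Delta,u:\varphi(y/x)\,/\,\mathcal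 R,\mathcal T,\Gamma\vdash\Delta,w:\forall x\varphi$, $u,y$ fresh; $(ds)$ $\mathcal R,\mathcal T,w:\mathrm{VT}(\vec t),\Gamma,w:p(\vec t)\vdash\Delta\,/\,\mathcal R,\mathcal T,\Gamma,w:p(\vec t)\vdash\Delta$. $\mathsf{LBIQ}(\mathrm{CD})$: remove $(ds)$, allow any $t\in\mathrm{Ter}$ in $(\exists R)$ and $(\forall L)$ (keeping $w\twoheadrightarrow^*_{\mathcal R}u$ in $(\forall L)$). Proofs are finite trees of rule instances with leaves (ax), $(\bot L)$, $(\top R)$; the height of a proof is the length of its longest branch. Sequents differing by a bijective label renaming are regarded as mutually derivable. -}

module Defs where

open import Data.Nat using (ℕ; zero; suc; _≡ᵇ_; _⊔_; _≟_)
open import Data.Bool using (Bool; true; false; if_then_else_; not)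
open import Data.List using (List; []; _∷_; _++_; map; concatMap; filterᵇ; foldr; length; lookup; deduplicate)
open import Data.Bool.ListAction using (any)
open import Data.Vec using (Vec; []; _∷_)
open import Data.Fin using (Fin)
open import Data.Product using (_×_; _,_; proj₁; proj₂; ∃)
open import Data.Unit using (⊤)
open import Data.Sum using (_⊎_)
open import Data.List.Membership.Propositional using (_∈_; _∉_)
open import Data.List.Relation.Unary.All using (All)
open import Data.List.Relation.Unary.Unique.Propositional using (Unique)
open import Data.List.Relation.Binary.Permutation.Propositional using (_↭_)
open import Relation.Binary.Construct.Closure.ReflexiveTransitive using (Star)
open import Relation.Binary.PropositionalEquality using (_≡_; _≢_)
open import Relation.Nullary using (¬_)

-- Signature: function symbols and predicate symbols are named by ℕ,
-- each with an arity (constants are function symbols of arity 0).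

record Sig : Set where
  field
    funAr  : ℕ → ℕ
    predAr : ℕ → ℕ

Var : Set
Var = ℕ

Lab : Set
Lab = ℕ

data Calc : Set where
  ID CD : Calc

module _ (Sg : Sig) where
  open Sig Sg

  data Term : Set where
    var : Var → Term
    fn  : (f : ℕ) → Vec Term (funAr f) → Term

  mutual
    -- VT(t): variables of a term (list, possibly with repetitions)
    varsT : Term → List Var
    varsT (var x)   = x ∷ []
    varsT (fn f ts) = varsTs ts

    varsTs : ∀ {n} → Vec Term n → List Var
    varsTs []       = []
    varsTs (t ∷ ts) = varsT t ++ varsTs ts

  mutual
    substT : (Var → Term) → Term → Term
    substT σ (var x)   = σ x
    substT σ (fn f ts) = fn f (substTs σ ts)

    substTs : ∀ {n} → (Var → Term) → Vec Term n → Vec Term n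
    substTs σ []       = []
    substTs σ (t ∷ ts) = substT σ t ∷ substTs σ ts

  infixr 30 _∧'_
  infixr 29 _∨'_
  infixr 28 _-<_
  infixr 27 _⇒_

  data Fm : Set where
    atom : (p : ℕ) → Vec Term (predAr p) → Fm
    ⊥' ⊤' : Fm
    _∧'_ _∨'_ _-<_ _⇒_ : Fm → Fm → Fm
    ex all : Var → Fm → Fm

  varsF : Fm → List Var
  varsF (atom p ts) = varsTs ts
  varsF ⊥'          = []
  varsF ⊤'          = []
  varsF (φ ∧' ψ)    = varsF φ ++ varsF ψ
  varsF (φ ∨' ψ)    = varsF φ ++ varsF ψ
  varsF (φ -< ψ)    = varsF φ ++ varsF ψ
  varsF (φ ⇒ ψ)     = varsF φ ++ varsF ψ
  varsF (ex x φ)    = x ∷ varsF φ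
  varsF (all x φ)   = x ∷ varsF φ

  fvF : Fm → List Var
  fvF (atom p ts) = varsTs ts
  fvF ⊥'          = []
  fvF ⊤'          = []
  fvF (φ ∧' ψ)    = fvF φ ++ fvF ψ
  fvF (φ ∨' ψ)    = fvF φ ++ fvF ψ
  fvF (φ -< ψ)    = fvF φ ++ fvF ψ
  fvF (φ ⇒ ψ)     = fvF φ ++ fvF ψ
  fvF (ex x φ)    = filterᵇ (λ y → not (y ≡ᵇ x)) (fvF φ)
  fvF (all x φ)   = filterᵇ (λ y → not (y ≡ᵇ x)) (fvF φ)

  update : (Var → Term) → Var → Term → Var → Term
  update σ x t y = if y ≡ᵇ x then t else σ y

  memb : Var → List Var → Bool
  memb x = any (λ y → y ≡ᵇ x)

  maxL : List ℕ → ℕ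
  maxL = foldr _⊔_ 0

  -- capture-avoiding simultaneous substitution: a bound variable is
  -- renamed (to a variable larger than every relevant one) exactly
  -- when it would capture a variable of the substituted terms.
  mutual
    substF : (Var → Term) → Fm → Fm
    substF σ (atom p ts) = atom p (substTs σ ts)
    substF σ ⊥'          = ⊥'
    substF σ ⊤'          = ⊤'
    substF σ (φ ∧' ψ)    = substF σ φ ∧' substF σ ψ
    substF σ (φ ∨' ψ)    = substF σ φ ∨' substF σ ψ
    substF σ (φ -< ψ)    = substF σ φ -< substF σ ψ
    substF σ (φ ⇒ ψ)     = substF σ φ ⇒ substF σ ψ
    substF σ (ex x φ)    = ex (binder σ x φ) (substF (update σ x (var (binder σ x φ))) φ)
    substF σ (all x φ)   = all (binder σ x φ) (substF (update σ x (var (binder σ x φ))) φ)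

    binder : (Var → Term) → Var → Fm → Var
    binder σ x φ =
      if memb x (avoid σ x φ) then suc (maxL (avoid σ x φ ++ varsF φ)) else x

    avoid : (Var → Term) → Var → Fm → List Var
    avoid σ x φ = concatMap (λ y → varsT (σ y)) (filterᵇ (λ y → not (y ≡ᵇ x)) (fvF φ))

  _[_/_] : Fm → Term → Var → Fm
  φ [ t / x ] = substF (update var x t) φ

  -- Sequents  R, T, Γ ⊢ Δ  (multisets represented by lists; all rules
  -- below are invariant under permutation of each component)

  RelAtoms : Set
  RelAtoms = List (Lab × Lab)          -- (w , u) stands for wRu

  DomAtoms : Set
  DomAtoms = List (Lab × Var)          -- (w , x) stands for w:x

  LFms : Set
  LFms = List (Lab × Fm)               -- (w , φ) stands for w:φ

  record Seq : Set where
    constructor mk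
    field
      Rs : RelAtoms
      Ts : DomAtoms
      Γs : LFms
      Δs : LFms

  labelsR : RelAtoms → List Lab
  labelsR = concatMap (λ e → proj₁ e ∷ proj₂ e ∷ [])

  labelsTΓΔ : Seq → List Lab
  labelsTΓΔ (mk R T Γ Δ) = map proj₁ T ++ map proj₁ Γ ++ map proj₁ Δ

  allLabels : Seq → List Lab
  allLabels S = labelsR (Seq.Rs S) ++ labelsTΓΔ S

  allVars : Seq → List Var
  allVars (mk R T Γ Δ) = map proj₂ T ++ concatMap (λ a → varsF (proj₂ a)) (Γ ++ Δ)

  FreshL : Lab → Seq → Set
  FreshL u S = u ∉ allLabels S

  FreshV : Var → Seq → Set
  FreshV y S = y ∉ allVars S

  Reach : RelAtoms → Lab → Lab → Set
  Reach R = Star (λ a b → (a , b) ∈ R)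

  InX : RelAtoms → DomAtoms → Lab → Var → Set
  InX R T w y = ∃ λ u → (u , y) ∈ T × Reach R u w

  Avail : RelAtoms → DomAtoms → Lab → Term → Set
  Avail R T w t = All (InX R T w) (varsT t)

  TermOK : Calc → RelAtoms → DomAtoms → Lab → Term → Set
  TermOK ID R T w t = Avail R T w t
  TermOK CD R T w t = ⊤

  domVT : Lab → ∀ {n} → Vec Term n → DomAtoms
  domVT w ts = map (λ y → (w , y)) (deduplicate _≟_ (varsTs ts))

  LabelCond : Seq → Set
  LabelCond S with Seq.Rs S
  ... | []    = ∃ λ w → (w ∈ labelsTΓΔ S) × All (λ v → v ≡ w) (labelsTΓΔ S)
  ... | _ ∷ _ = All (λ v → v ∈ labelsR (Seq.Rs S)) (labelsTΓΔ S)

  UEdge : RelAtoms → Lab → Lab → Set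
  UEdge R a b = ((a , b) ∈ R) ⊎ ((b , a) ∈ R)

  Connected : RelAtoms → Set
  Connected R = ∀ a b → a ∈ labelsR R → b ∈ labelsR R → Star (UEdge R) a b

  -- undirected trails: walks in the underlying multigraph of R, recorded
  -- by the positions (edge occurrences) of R they traverse, in either
  -- direction
  data Trail (R : RelAtoms) : Lab → Lab → List (Fin (length R)) → Set where
    done : ∀ {a} → Trail R a a []
    fwd  : ∀ {c es} (i : Fin (length R)) →
           Trail R (proj₂ (lookup R i)) c es → Trail R (proj₁ (lookup R i)) c (i ∷ es)
    bwd  : ∀ {c es} (i : Fin (length R)) →
           Trail R (proj₁ (lookup R i)) c es → Trail R (proj₂ (lookup R i)) c (i ∷ es)

  Acyclic : RelAtoms → Set
  Acyclic R = ∀ a i es → Trail R a a (i ∷ es) → ¬ Unique (i ∷ es)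

  IsSequent : Seq → Set
  IsSequent S = LabelCond S × Connected (Seq.Rs S) × Acyclic (Seq.Rs S)

  -- LBIQ(C): Prf C S n  means  "S has a proof of height n in LBIQ(C)"
  -- (leaves have height 0; a rule adds 1 to the max of its premises).
  -- Principal formulae are located up to permutation (multisets).

  data Prf (C : Calc) : Seq → ℕ → Set where
    ax   : ∀ {R T Γ Δ w u p ts} →
           (w , atom p ts) ∈ Γ → (u , atom p ts) ∈ Δ → Reach R w u →
           Prf C (mk R T Γ Δ) 0
    botL : ∀ {R T Γ Δ w} → (w , ⊥') ∈ Γ → Prf C (mk R T Γ Δ) 0
    topR : ∀ {R T Γ Δ w} → (w , ⊤') ∈ Δ → Prf C (mk R T Γ Δ) 0
    andL : ∀ {R T Γ Γ' Δ w φ ψ n} → Γ ↭ ((w , φ ∧' ψ) ∷ Γ') →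
           Prf C (mk R T ((w , φ) ∷ (w , ψ) ∷ Γ') Δ) n →
           Prf C (mk R T Γ Δ) (suc n)
    andR : ∀ {R T Γ Δ Δ' w φ ψ n₁ n₂} → Δ ↭ ((w , φ ∧' ψ) ∷ Δ') →
           Prf C (mk R T Γ ((w , φ) ∷ Δ')) n₁ →
           Prf C (mk R T Γ ((w , ψ) ∷ Δ')) n₂ →
           Prf C (mk R T Γ Δ) (suc (n₁ ⊔ n₂))
    orL  : ∀ {R T Γ Γ' Δ w φ ψ n₁ n₂} → Γ ↭ ((w , φ ∨' ψ) ∷ Γ') →
           Prf C (mk R T ((w , φ) ∷ Γ') Δ) n₁ →
           Prf C (mk R T ((w , ψ) ∷ Γ') Δ) n₂ →
           Prf C (mk R T Γ Δ) (suc (n₁ ⊔ n₂))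
    orR  : ∀ {R T Γ Δ Δ' w φ ψ n} → Δ ↭ ((w , φ ∨' ψ) ∷ Δ') →
           Prf C (mk R T Γ ((w , φ) ∷ (w , ψ) ∷ Δ')) n →
           Prf C (mk R T Γ Δ) (suc n)
    impL : ∀ {R T Γ Δ w u φ ψ n₁ n₂} → (w , φ ⇒ ψ) ∈ Γ → Reach R w u →
           Prf C (mk R T Γ ((u , φ) ∷ Δ)) n₁ →
           Prf C (mk R T ((u , ψ) ∷ Γ) Δ) n₂ →
           Prf C (mk R T Γ Δ) (suc (n₁ ⊔ n₂))
    impR : ∀ {R T Γ Δ Δ' w u φ ψ n} → Δ ↭ ((w , φ ⇒ ψ) ∷ Δ') →
           FreshL u (mk R T Γ Δ) →
           Prf C (mk ((w , u) ∷ R) T ((u , φ) ∷ Γ) ((u , ψ) ∷ Δ')) n →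
           Prf C (mk R T Γ Δ) (suc n)
    exclL : ∀ {R T Γ Γ' Δ w u φ ψ n} → Γ ↭ ((w , φ -< ψ) ∷ Γ') →
           FreshL u (mk R T Γ Δ) →
           Prf C (mk ((u , w) ∷ R) T ((u , φ) ∷ Γ') ((u , ψ) ∷ Δ)) n →
           Prf C (mk R T Γ Δ) (suc n)
    exclR : ∀ {R T Γ Δ w u φ ψ n₁ n₂} → (u , φ -< ψ) ∈ Δ → Reach R w u →
           Prf C (mk R T Γ ((w , φ) ∷ Δ)) n₁ →
           Prf C (mk R T ((w , ψ) ∷ Γ) Δ) n₂ →
           Prf C (mk R T Γ Δ) (suc (n₁ ⊔ n₂))
    exL  : ∀ {R T Γ Γ' Δ w x y φ n} → Γ ↭ ((w , ex x φ) ∷ Γ') →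
           FreshV y (mk R T Γ Δ) →
           Prf C (mk R ((w , y) ∷ T) ((w , φ [ var y / x ]) ∷ Γ') Δ) n →
           Prf C (mk R T Γ Δ) (suc n)
    exR  : ∀ {R T Γ Δ w x φ t n} → (w , ex x φ) ∈ Δ → TermOK C R T w t →
           Prf C (mk R T Γ ((w , φ [ t / x ]) ∷ Δ)) n →
           Prf C (mk R T Γ Δ) (suc n)
    allL : ∀ {R T Γ Δ w u x φ t n} → (w , all x φ) ∈ Γ → Reach R w u →
           TermOK C R T u t →
           Prf C (mk R T ((u , φ [ t / x ]) ∷ Γ) Δ) n →
           Prf C (mk R T Γ Δ) (suc n)
    allR : ∀ {R T Γ Δ Δ' w u x y φ n} → Δ ↭ ((w , all x φ) ∷ Δ') →
           FreshL u (mk R T Γ Δ) → FreshV y (mk R T Γ Δ) →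
           Prf C (mk ((w , u) ∷ R) ((u , y) ∷ T) Γ ((u , φ [ var y / x ]) ∷ Δ')) n →
           Prf C (mk R T Γ Δ) (suc n)
    ds   : ∀ {R T Γ Δ w p ts n} → C ≡ ID → (w , atom p ts) ∈ Γ →
           Prf C (mk R (domVT w ts ++ T) Γ Δ) n →
           Prf C (mk R T Γ Δ) (suc n)

-- Since w ↠* u, every label that sees u : x also sees w : x, so dropping
-- u : x leaves every domain X_v unchanged; the availability side conditions
-- of (∃R) and (∀L) therefore still hold, and the freshness conditions only
-- get weaker as T shrinks. Hence the same derivation, rule by rule, proves
-- the contracted sequent, at the same height.
module Submission where

open import Defs
open import Data.Nat using (ℕ; _≤_)
open import Data.Nat.Properties using (≤-refl)
open import Data.Product using (_×_; _,_; ∃; proj₁; proj₂)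
open import Data.List using ([]; _∷_; _++_; map; concatMap)
open import Data.Sum using (inj₁; inj₂)
open import Data.Unit using (tt)
open import Data.List.Relation.Unary.Any using (here; there)
import Data.List.Relation.Unary.All as All
open import Data.List.Relation.Binary.Subset.Propositional using (_⊆_)
open import Data.List.Relation.Binary.Subset.Propositional.Properties
  using (⊆-refl; ++⁺; ++⁺ʳ; map⁺)
open import Data.List.Membership.Propositional using (_∈_)
open import Data.List.Membership.Propositional.Properties using (∈-++⁻; ∈-++⁺ˡ; ∈-++⁺ʳ)
open import Relation.Binary.Construct.Closure.ReflexiveTransitive using (ε; _◅◅_)
import Relation.Binary.Construct.Closure.ReflexiveTransitive as Star
open import Relation.Binary.PropositionalEquality using (refl)

module _ (Sg : Sig) where

  Reach-∷ : ∀ {R a b} e → Reach Sg R a b → Reach Sg (e ∷ R) a b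
  Reach-∷ e = Star.map there

  record Covers (R : RelAtoms Sg) (T T′ : DomAtoms Sg) : Set where
    field
      sub       : T′ ⊆ T
      dominated : ∀ {a y} → (a , y) ∈ T → ∃ λ b → (b , y) ∈ T′ × Reach Sg R b a

  open Covers

  Covers-∷ʳ : ∀ {R T T′} e → Covers R T T′ → Covers (e ∷ R) T T′
  Covers-∷ʳ e cov .sub = cov .sub
  Covers-∷ʳ e cov .dominated p =
    let (b , q , r) = cov .dominated p in b , q , Reach-∷ e r

  Covers-++ : ∀ {R T T′} zs → Covers R T T′ → Covers R (zs ++ T) (zs ++ T′)
  Covers-++ zs cov .sub = ++⁺ʳ zs (cov .sub)
  Covers-++ zs cov .dominated p with ∈-++⁻ zs p
  ... | inj₁ q = _ , ∈-++⁺ˡ q , ε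
  ... | inj₂ q = let (b , q′ , r) = cov .dominated q in b , ∈-++⁺ʳ zs q′ , r

  Covers-∷ : ∀ {R T T′} d → Covers R T T′ → Covers R (d ∷ T) (d ∷ T′)
  Covers-∷ d = Covers-++ (d ∷ [])

  InX-covers : ∀ {R T T′ w y} → Covers R T T′ → InX Sg R T w y → InX Sg R T′ w y
  InX-covers cov (a , p , r) = let (b , q , r′) = cov .dominated p in b , q , r′ ◅◅ r

  TermOK-covers : ∀ C {R T T′ w t} → Covers R T T′ →
                  TermOK Sg C R T w t → TermOK Sg C R T′ w t
  TermOK-covers ID cov ok = All.map (InX-covers cov) ok
  TermOK-covers CD cov ok = tt

  FreshL-⊆ : ∀ R Γ Δ {T T′ u} → T′ ⊆ T →
             FreshL Sg u (mk R T Γ Δ) → FreshL Sg u (mk R T′ Γ Δ)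
  FreshL-⊆ R Γ Δ s fresh p =
    fresh (++⁺ {xs = labelsR Sg R} ⊆-refl
                (++⁺ (map⁺ proj₁ s) (⊆-refl {x = map proj₁ Γ ++ map proj₁ Δ})) p)

  FreshV-⊆ : ∀ R Γ Δ {T T′ y} → T′ ⊆ T →
             FreshV Sg y (mk R T Γ Δ) → FreshV Sg y (mk R T′ Γ Δ)
  FreshV-⊆ R Γ Δ s fresh p =
    fresh (++⁺ (map⁺ proj₂ s) (⊆-refl {x = concatMap (λ a → varsF Sg (proj₂ a)) (Γ ++ Δ)}) p)

  Prf-covers : ∀ {C R T T′ Γ Δ n} → Covers R T T′ →
               Prf Sg C (mk R T Γ Δ) n → Prf Sg C (mk R T′ Γ Δ) n
  Prf-covers cov (ax p q r)      = ax p q r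
  Prf-covers cov (botL p)        = botL p
  Prf-covers cov (topR p)        = topR p
  Prf-covers cov (andL p d)      = andL p (Prf-covers cov d)
  Prf-covers cov (andR p d e)    = andR p (Prf-covers cov d) (Prf-covers cov e)
  Prf-covers cov (orL p d e)     = orL p (Prf-covers cov d) (Prf-covers cov e)
  Prf-covers cov (orR p d)       = orR p (Prf-covers cov d)
  Prf-covers cov (impL p r d e)  = impL p r (Prf-covers cov d) (Prf-covers cov e)
  Prf-covers cov (exclR p r d e) = exclR p r (Prf-covers cov d) (Prf-covers cov e)
  Prf-covers {C} cov (exR p ok d)     = exR p (TermOK-covers C cov ok) (Prf-covers cov d)
  Prf-covers {C} cov (allL p r ok d)  = allL p r (TermOK-covers C cov ok) (Prf-covers cov d)
  Prf-covers cov (ds eq p d)     = ds eq p (Prf-covers (Covers-++ _ cov) d)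
  Prf-covers {R = R} {Γ = Γ} {Δ} cov (impR p fu d) =
    impR p (FreshL-⊆ R Γ Δ (cov .sub) fu) (Prf-covers (Covers-∷ʳ _ cov) d)
  Prf-covers {R = R} {Γ = Γ} {Δ} cov (exclL p fu d) =
    exclL p (FreshL-⊆ R Γ Δ (cov .sub) fu) (Prf-covers (Covers-∷ʳ _ cov) d)
  Prf-covers {R = R} {Γ = Γ} {Δ} cov (exL p fy d) =
    exL p (FreshV-⊆ R Γ Δ (cov .sub) fy) (Prf-covers (Covers-∷ _ cov) d)
  Prf-covers {R = R} {Γ = Γ} {Δ} cov (allR p fu fy d) =
    allR p (FreshL-⊆ R Γ Δ (cov .sub) fu) (FreshV-⊆ R Γ Δ (cov .sub) fy)
           (Prf-covers (Covers-∷ _ (Covers-∷ʳ _ cov)) d)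

  Covers-contract : ∀ {R T w u x} → Reach Sg R w u →
                    Covers R ((w , x) ∷ (u , x) ∷ T) ((w , x) ∷ T)
  Covers-contract r .sub (here q)  = here q
  Covers-contract r .sub (there q) = there (there q)
  Covers-contract r .dominated (here refl)         = _ , here refl , ε
  Covers-contract r .dominated (there (here refl)) = _ , here refl , r
  Covers-contract r .dominated (there (there q))   = _ , there q , ε

lemma32 : (Sg : Sig) (C : Calc) (R : RelAtoms Sg) (T : DomAtoms Sg) (Γ Δ : LFms Sg)
          (w u : Lab) (x : Var) (n : ℕ) →
          IsSequent Sg (mk R ((w , x) ∷ (u , x) ∷ T) Γ Δ) →
          Reach Sg R w u →
          Prf Sg C (mk R ((w , x) ∷ (u , x) ∷ T) Γ Δ) n →
          ∃ λ m → m ≤ n × Prf Sg C (mk R ((w , x) ∷ T) Γ Δ) m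
lemma32 Sg C R T Γ Δ w u x n _ w↠u d =
  n , ≤-refl , Prf-covers Sg (Covers-contract Sg w↠u) d
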